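{- Let $1 \le j \le n-1$ and let $k \ge 1$ be an integer. Every vector $(z,z') \in K_{j+1}^+ \cup K_{j+1}^-$ with $\|z\|_1 \le k$ can be written as a finite positive integer linear combination $\sum_i \alpha_i (g_i, g_i')$ with $\alpha_i \in \mathbb{Z}_{>0}$, $(g_i,g_i') \in \mathcal{G}_{\le k} := \mathcal{G}_0 \cup \mathcal{G}_1 \cup \dots \cup \mathcal{G}_k$, and $(g_i,g_i') \sqsubseteq_{j+1} (z,z')$ for all $i$.
   Context: Let $1 \le s \le n$ and let $p_1,\dots,p_s \in \mathbb{Z}^n$ be such that $p_i$ has its first $i-1$ coordinates equal to $0$ and its $i$-th coordinate $p_{i,i} > 0$. Let $\Lambda \subseteq \mathbb{Z}^n$ be the lattice generated by $p_1,\dots,p_s$ over $\mathbb{Z}$. For $m \ge j$ let $\pi_j^m : \mathbb{R}^m \to \mathbb{R}^j$ be the projection onto the first $j$ coordinates. Let $K_j := \{\pi_j^n(v) : v \in \Lambda\}$, $K_j^+ := K_j \cap (\mathbb{R}_+^{j-1} \times \mathbb{R}_+)$, $K_j^- := K_j \cap (\mathbb{R}_+^{j-1} \times \mathbb{R}_-)$ (with $\mathbb{R}_+=[0,\infty)$, $\mathbb{R}_-=(-\infty,0]$), and let $H_j^+, H_j^-$ be the unique inclusion-minimal generating sets of the monoids $(K_j^+,+)$, $(K_j^-,+)$. Vectors of $\mathbb{Z}^{j+1}$ are written $(v,v')$ with $v \in \mathbb{Z}^j$, $v' \in \mathbb{Z}$, and $\|v\|_1 = \sum_{i=1}^j |v^{(i)}|$.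 For $i \ge 0$ let $\mathcal{G}_i := \{(v,v') \in H_{j+1}^+ \cup H_{j+1}^- : \|v\|_1 = i\}$. For $u,v \in \mathbb{R}^{j+1}$ write $u \sqsubseteq_{j+1} v$ iff $u^{(i)} \le v^{(i)}$ for $i=1,\dots,j$, $|u^{(j+1)}| \le |v^{(j+1)}|$, and $u^{(j+1)} v^{(j+1)} \ge 0$. -}

module Defs where

open import Data.Nat as ℕ using (ℕ; zero; suc)
open import Data.Integer as ℤ using (ℤ; +_; ∣_∣)
open import Data.Fin as Fin using (Fin; toℕ; inject≤)
open import Data.Vec using (Vec; []; _∷_; lookup; tabulate; zipWith; replicate; map; init; last; _∷ʳ_)
open import Data.List using (List)
open import Data.List.Relation.Unary.All using (All)
open import Data.Product using (Σ; ∃; _×_; _,_)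
open import Data.Sum using (_⊎_)
open import Relation.Binary.PropositionalEquality using (_≡_)

ℤVec : ℕ → Set
ℤVec m = Vec ℤ m

0v : ∀ {m} → ℤVec m
0v {m} = replicate m (+ 0)

_+v_ : ∀ {m} → ℤVec m → ℤVec m → ℤVec m
_+v_ = zipWith ℤ._+_

_•_ : ∀ {m} → ℤ → ℤVec m → ℤVec m
a • v = map (a ℤ.*_) v

linComb : ∀ {s m} → Vec ℤ s → Vec (ℤVec m) s → ℤVec m
linComb []       []       = 0v
linComb (c ∷ cs) (p ∷ ps) = (c • p) +v linComb cs ps

sumList : ∀ {m} → List (ℤVec m) → ℤVec m
sumList Data.List.[] = 0v
sumList (v Data.List.∷ vs) = v +v sumList vs

sumComb : ∀ {m} → List (ℤ × ℤVec m) → ℤVec m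
sumComb Data.List.[] = 0v
sumComb ((a , v) Data.List.∷ vs) = (a • v) +v sumComb vs

norm1 : ∀ {m} → ℤVec m → ℕ
norm1 []       = 0
norm1 (x ∷ xs) = ∣ x ∣ ℕ.+ norm1 xs

Nonneg : ∀ {m} → ℤVec m → Set
Nonneg v = ∀ i → + 0 ℤ.≤ lookup v i

_≤v_ : ∀ {m} → ℤVec m → ℤVec m → Set
u ≤v v = ∀ i → lookup u i ℤ.≤ lookup v i

-- Standing hypothesis on p_1,…,p_s (0-indexed): p_i has the coordinates
-- before position i equal to 0 and coordinate i strictly positive.
Triangular : ∀ {s n} → Vec (ℤVec n) s → Set
Triangular {s} {n} p =
  (i : Fin s) (t : Fin n) →
    (toℕ t ℕ.< toℕ i → lookup (lookup p i) t ≡ + 0) ×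
    (toℕ t ≡ toℕ i → + 0 ℤ.< lookup (lookup p i) t)

InΛ : ∀ {s n} → Vec (ℤVec n) s → ℤVec n → Set
InΛ {s} p v = Σ (Vec ℤ s) λ c → v ≡ linComb c p

π : ∀ {n} (d : ℕ) → .(d ℕ.≤ n) → ℤVec n → ℤVec d
π d d≤n v = tabulate λ t → lookup v (inject≤ t d≤n)

InK : ∀ {s n} → Vec (ℤVec n) s → (d : ℕ) → .(d ℕ.≤ n) → ℤVec d → Set
InK {n = n} p d d≤n w = Σ (ℤVec n) λ v → InΛ p v × w ≡ π d d≤n v

InK⁺ : ∀ {s n} → Vec (ℤVec n) s → (m : ℕ) → .(suc m ℕ.≤ n) → ℤVec (suc m) → Set
InK⁺ p m le w = InK p (suc m) le w × Nonneg (init w) × + 0 ℤ.≤ last w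

InK⁻ : ∀ {s n} → Vec (ℤVec n) s → (m : ℕ) → .(suc m ℕ.≤ n) → ℤVec (suc m) → Set
InK⁻ p m le w = InK p (suc m) le w × Nonneg (init w) × last w ℤ.≤ + 0

Generates : ∀ {m} → (ℤVec m → Set) → (ℤVec m → Set) → Set
Generates {m} M H =
  (∀ x → H x → M x) ×
  (∀ x → M x → Σ (List (ℤVec m)) λ gs → All H gs × x ≡ sumList gs)

MinimalGenerating : ∀ {m} → (ℤVec m → Set) → (ℤVec m → Set) → Set₁
MinimalGenerating {m} M H =
  Generates M H ×
  ((H' : ℤVec m → Set) → (∀ x → H' x → H x) → Generates M H' → ∀ x → H x → H' x)

𝒢 : ∀ {m} → (H⁺ H⁻ : ℤVec (suc m) → Set) → ℕ → Vec ℤ m → ℤ → Set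
𝒢 H⁺ H⁻ i v v' = (H⁺ (v ∷ʳ v') ⊎ H⁻ (v ∷ʳ v')) × norm1 v ≡ i

𝒢≤ : ∀ {m} → (H⁺ H⁻ : ℤVec (suc m) → Set) → ℕ → Vec ℤ m → ℤ → Set
𝒢≤ H⁺ H⁻ k v v' = Σ ℕ λ i → i ℕ.≤ k × 𝒢 H⁺ H⁻ i v v'

_⊑_ : ∀ {m} → Vec ℤ m × ℤ → Vec ℤ m × ℤ → Set
(u , u') ⊑ (v , v') = u ≤v v × ∣ u' ∣ ℕ.≤ ∣ v' ∣ × + 0 ℤ.≤ u' ℤ.* v'

{-# OPTIONS --safe #-}
-- Write (z , z') ∈ K⁺ (or K⁻) as a sum of elements of the generating set H⁺ (or H⁻), and
-- use each generator with coefficient 1. All summands lie in the same closed orthant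
-- ℤ₊ʲ × ℤ₊ (or ℤ₊ʲ × ℤ₋) as their sum, so each one lies coordinatewise between 0 and
-- (z , z'): it is ⊑ (z , z') and its first j coordinates have ℓ₁-norm at most ‖z‖₁ ≤ k.
module Submission where

open import Defs
open import Data.Nat as ℕ using (ℕ; suc)
open import Data.Integer as ℤ using (ℤ; +_)
open import Data.Vec using (Vec; _∷ʳ_)
open import Data.List using (List; map)
open import Data.List.Relation.Unary.All using (All)
open import Data.Product using (Σ; _×_; _,_; proj₁; proj₂)
open import Data.Sum using (_⊎_)
open import Relation.Binary.PropositionalEquality using (_≡_)

open import Data.Fin using (Fin; zero; suc)
open import Data.Vec as Vec using ([]; _∷_; init; last; lookup)
import Data.Vec.Properties as Vec
open import Data.List using (foldr; []; _∷_)
open import Data.List.Membership.Propositional using (_∈_)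
open import Data.List.Membership.Propositional.Properties using (∈-map⁺)
open import Data.List.Relation.Unary.Any using (here; there)
open import Data.List.Relation.Unary.All as All using ([]; _∷_)
import Data.List.Relation.Unary.All.Properties as All
open import Data.Product using (uncurry)
open import Data.Sum using (inj₁; inj₂)
open import Function using (_∘_)
open import Relation.Binary.PropositionalEquality using (refl; sym; trans; cong; cong₂; subst)
import Data.Integer.Properties as ℤ
import Data.Nat.Properties as ℕ

∑ : List ℤ → ℤ
∑ = foldr ℤ._+_ (+ 0)

-- The last-coordinate part of ⊑: x lies between 0 and y.
_⊑ℤ_ : ℤ → ℤ → Set
x ⊑ℤ y = ℤ.∣ x ∣ ℕ.≤ ℤ.∣ y ∣ × + 0 ℤ.≤ x ℤ.* y

nonneg-⊑ℤ : ∀ {x y} → + 0 ℤ.≤ x → x ℤ.≤ y → x ⊑ℤ y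
nonneg-⊑ℤ {+ m} {+ n} _ (ℤ.+≤+ m≤n) = m≤n , subst (+ 0 ℤ.≤_) (ℤ.pos-* m n) (ℤ.+≤+ ℕ.z≤n)

nonpos-⊑ℤ : ∀ {x y} → x ℤ.≤ + 0 → y ℤ.≤ x → x ⊑ℤ y
nonpos-⊑ℤ {+ 0}        _     _           = ℕ.z≤n , ℤ.+≤+ ℕ.z≤n
nonpos-⊑ℤ {ℤ.-[1+ _ ]} ℤ.-≤+ (ℤ.-≤- n≤m) = ℕ.s≤s n≤m , ℤ.+≤+ ℕ.z≤n
nonpos-⊑ℤ {+ suc _}    (ℤ.+≤+ ())

∑-nonneg : ∀ {xs} → All (+ 0 ℤ.≤_) xs → + 0 ℤ.≤ ∑ xs
∑-nonneg []           = ℤ.≤-refl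
∑-nonneg (x≥0 ∷ xs≥0) = ℤ.+-mono-≤ x≥0 (∑-nonneg xs≥0)

∑-nonpos : ∀ {xs} → All (ℤ._≤ + 0) xs → ∑ xs ℤ.≤ + 0
∑-nonpos []           = ℤ.≤-refl
∑-nonpos (x≤0 ∷ xs≤0) = ℤ.+-mono-≤ x≤0 (∑-nonpos xs≤0)

summand≤∑ : ∀ {xs x} → All (+ 0 ℤ.≤_) xs → x ∈ xs → x ℤ.≤ ∑ xs
summand≤∑ {x = x} (_ ∷ xs≥0) (here refl) =
  ℤ.≤-trans (ℤ.≤-reflexive (sym (ℤ.+-identityʳ x))) (ℤ.+-monoʳ-≤ x (∑-nonneg xs≥0))
summand≤∑ {x = x} (y≥0 ∷ xs≥0) (there x∈xs) =
  ℤ.≤-trans (ℤ.≤-reflexive (sym (ℤ.+-identityˡ x))) (ℤ.+-mono-≤ y≥0 (summand≤∑ xs≥0 x∈xs))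

∑≤summand : ∀ {xs x} → All (ℤ._≤ + 0) xs → x ∈ xs → ∑ xs ℤ.≤ x
∑≤summand {x = x} (_ ∷ xs≤0) (here refl) =
  ℤ.≤-trans (ℤ.+-monoʳ-≤ x (∑-nonpos xs≤0)) (ℤ.≤-reflexive (ℤ.+-identityʳ x))
∑≤summand {x = x} (y≤0 ∷ xs≤0) (there x∈xs) =
  ℤ.≤-trans (ℤ.+-mono-≤ y≤0 (∑≤summand xs≤0 x∈xs)) (ℤ.≤-reflexive (ℤ.+-identityˡ x))

SummandsBelowSum : (ℤ → Set) → Set
SummandsBelowSum S = ∀ {xs x} → All S xs → x ∈ xs → x ⊑ℤ ∑ xs

nonneg-summandsBelowSum : SummandsBelowSum (+ 0 ℤ.≤_)
nonneg-summandsBelowSum xs≥0 x∈xs =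
  nonneg-⊑ℤ (All.lookup xs≥0 x∈xs) (summand≤∑ xs≥0 x∈xs)

nonpos-summandsBelowSum : SummandsBelowSum (ℤ._≤ + 0)
nonpos-summandsBelowSum xs≤0 x∈xs =
  nonpos-⊑ℤ (All.lookup xs≤0 x∈xs) (∑≤summand xs≤0 x∈xs)

norm1-mono : ∀ {m} {u v : ℤVec m} → Nonneg u → u ≤v v → norm1 u ℕ.≤ norm1 v
norm1-mono {u = []}    {[]}    _   _    = ℕ.z≤n
norm1-mono {u = _ ∷ u} {_ ∷ v} u≥0 u≤v =
  ℕ.+-mono-≤ (proj₁ (nonneg-⊑ℤ (u≥0 zero) (u≤v zero)))
             (norm1-mono {u = u} {v} (u≥0 ∘ suc) (u≤v ∘ suc))

lookup-sumList : ∀ {m} (i : Fin m) (vs : List (ℤVec m)) →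
                 lookup (sumList vs) i ≡ ∑ (map (λ v → lookup v i) vs)
lookup-sumList i []       = Vec.lookup-replicate i (+ 0)
lookup-sumList i (v ∷ vs) =
  trans (Vec.lookup-zipWith ℤ._+_ i v (sumList vs))
        (cong (ℤ._+_ (lookup v i)) (lookup-sumList i vs))

summand≤v-sumList : ∀ {m} {vs : List (ℤVec m)} {v} → All Nonneg vs → v ∈ vs → v ≤v sumList vs
summand≤v-sumList {vs = vs} {v} vs≥0 v∈vs i =
  subst (lookup v i ℤ.≤_) (sym (lookup-sumList i vs))
    (summand≤∑ (All.map⁺ (All.map (λ v≥0 → v≥0 i) vs≥0)) (∈-map⁺ (λ w → lookup w i) v∈vs))

+v-∷ʳ : ∀ {m} (u v : ℤVec m) x y → (u ∷ʳ x) +v (v ∷ʳ y) ≡ (u +v v) ∷ʳ (x ℤ.+ y)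
+v-∷ʳ []      []      x y = refl
+v-∷ʳ (a ∷ u) (b ∷ v) x y = cong (a ℤ.+ b ∷_) (+v-∷ʳ u v x y)

0v-∷ʳ : ∀ m → 0v {suc m} ≡ 0v {m} ∷ʳ + 0
0v-∷ʳ ℕ.zero  = refl
0v-∷ʳ (suc m) = cong (+ 0 ∷_) (0v-∷ʳ m)

init-∷ʳ-last : ∀ {m} (w : ℤVec (suc m)) → init w ∷ʳ last w ≡ w
init-∷ʳ-last w = sym (proj₂ (proj₂ (Vec.initLast w)))

sumList-∷ʳ : ∀ {m} (ws : List (ℤVec (suc m))) →
             sumList ws ≡ sumList (map init ws) ∷ʳ ∑ (map last ws)
sumList-∷ʳ {m} [] = 0v-∷ʳ m
sumList-∷ʳ (w ∷ ws) =
  trans (cong₂ _+v_ (sym (init-∷ʳ-last w)) (sumList-∷ʳ ws))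
        (+v-∷ʳ (init w) (sumList (map init ws)) (last w) (∑ (map last ws)))

Orthant : ∀ {m} → (ℤ → Set) → ℤVec (suc m) → Set
Orthant S w = Nonneg (init w) × S (last w)

summand-⊑-sumList : ∀ {m} {S : ℤ → Set} {ws : List (ℤVec (suc m))} {w} →
  SummandsBelowSum S → All (Orthant S) ws → w ∈ ws →
  (init w , last w) ⊑ (sumList (map init ws) , ∑ (map last ws))
summand-⊑-sumList {S = S} {w = w} below ws∈O w∈ws =
  summand≤v-sumList (All.map⁺ {f = init} (All.map proj₁ ws∈O)) (∈-map⁺ init w∈ws) ,
  below (All.map⁺ {P = S} {f = last} (All.map proj₂ ws∈O)) (∈-map⁺ last w∈ws)

GeneratorsBelow : ∀ {m} → (ℤVec (suc m) → Set) → Vec ℤ m → ℤ → Set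
GeneratorsBelow {m} H z z' =
  Σ (List (ℤVec (suc m))) λ gs →
    All (λ g → H g × Nonneg (init g) × (init g , last g) ⊑ (z , z')) gs × z ∷ʳ z' ≡ sumList gs

generatorsBelow : ∀ {m} {S : ℤ → Set} {M H : ℤVec (suc m) → Set} {z z'} →
  SummandsBelowSum S → Generates M H → (∀ {w} → M w → Orthant S w) →
  M (z ∷ʳ z') → GeneratorsBelow H z z'
generatorsBelow {S = S} {H = H} {z} {z'} below (H⊆M , decompose) M⊆O z∈M
  with decompose _ z∈M
... | gs , gs∈H , z≡∑gs = gs , All.tabulate bounded , z≡∑gs
  where
  gs∈O : All (Orthant S) gs
  gs∈O = All.map (M⊆O ∘ H⊆M _) gs∈H
  z-split : (sumList (map init gs) , ∑ (map last gs)) ≡ (z , z')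
  z-split = sym (uncurry (cong₂ _,_)
    (Vec.∷ʳ-injective z _ (trans z≡∑gs (sumList-∷ʳ gs))))
  bounded : ∀ {g} → g ∈ gs → H g × Nonneg (init g) × (init g , last g) ⊑ (z , z')
  bounded {g} g∈gs =
    All.lookup gs∈H g∈gs ,
    proj₁ (All.lookup gs∈O g∈gs) ,
    subst ((init g , last g) ⊑_) z-split (summand-⊑-sumList below gs∈O g∈gs)

𝒢≤-Combination : ∀ {j} → (H⁺ H⁻ : ℤVec (suc j) → Set) → ℕ → Vec ℤ j → ℤ → Set
𝒢≤-Combination {j} H⁺ H⁻ k z z' =
  Σ (List (ℤ × (Vec ℤ j × ℤ))) λ terms →
    All (λ t → + 0 ℤ.< proj₁ t
               × 𝒢≤ H⁺ H⁻ k (proj₁ (proj₂ t)) (proj₂ (proj₂ t))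
               × proj₂ t ⊑ (z , z')) terms
    × z ∷ʳ z' ≡ sumComb (map (λ t → proj₁ t , (proj₁ (proj₂ t) ∷ʳ proj₂ (proj₂ t))) terms)

unitTerm : ∀ {m} → ℤVec (suc m) → ℤ × (Vec ℤ m × ℤ)
unitTerm g = + 1 , init g , last g

1•v≡v : ∀ {m} (v : ℤVec m) → (+ 1) • v ≡ v
1•v≡v v = trans (Vec.map-cong ℤ.*-identityˡ v) (Vec.map-id v)

sumComb-unitTerms : ∀ {m} (gs : List (ℤVec (suc m))) →
  sumComb (map (λ t → proj₁ t , (proj₁ (proj₂ t) ∷ʳ proj₂ (proj₂ t))) (map unitTerm gs)) ≡ sumList gs
sumComb-unitTerms []       = refl
sumComb-unitTerms (g ∷ gs) =
  cong₂ _+v_ (trans (1•v≡v _) (init-∷ʳ-last g)) (sumComb-unitTerms gs)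

unitCombination : ∀ {j} {H H⁺ H⁻ : ℤVec (suc j) → Set} {k z z'} →
  (∀ {g} → H g → H⁺ g ⊎ H⁻ g) → norm1 z ℕ.≤ k →
  GeneratorsBelow H z z' → 𝒢≤-Combination H⁺ H⁻ k z z'
unitCombination {H = H} {H⁺} {H⁻} {k} {z} {z'} H⊆H± ‖z‖≤k (gs , gs-below , z≡∑gs) =
  map unitTerm gs ,
  All.map⁺ (All.map unitTerm-valid gs-below) ,
  trans z≡∑gs (sym (sumComb-unitTerms gs))
  where
  unitTerm-valid : ∀ {g} → H g × Nonneg (init g) × (init g , last g) ⊑ (z , z') →
    + 0 ℤ.< + 1 × 𝒢≤ H⁺ H⁻ k (init g) (last g) × (init g , last g) ⊑ (z , z')
  unitTerm-valid {g} (g∈H , init-g≥0 , g⊑z) =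
    ℤ.+<+ ℕ.z<s ,
    (norm1 (init g) ,
     ℕ.≤-trans (norm1-mono {u = init g} {z} init-g≥0 (proj₁ g⊑z)) ‖z‖≤k ,
     subst (λ w → H⁺ w ⊎ H⁻ w) (sym (init-∷ʳ-last g)) (H⊆H± g∈H) ,
     refl) ,
    g⊑z

lemma3p1 : (n s : ℕ) → 1 ℕ.≤ s → s ℕ.≤ n →
    (p : Vec (ℤVec n) s) → Triangular p →
    (j : ℕ) → 1 ℕ.≤ j → (le : suc j ℕ.≤ n) →
    (k : ℕ) → 1 ℕ.≤ k →
    (H⁺ H⁻ : ℤVec (suc j) → Set) →
    MinimalGenerating (InK⁺ p j le) H⁺ →
    MinimalGenerating (InK⁻ p j le) H⁻ →
    (z : Vec ℤ j) (z' : ℤ) →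
    (InK⁺ p j le (z ∷ʳ z') ⊎ InK⁻ p j le (z ∷ʳ z')) →
    norm1 z ℕ.≤ k →
    Σ (List (ℤ × (Vec ℤ j × ℤ))) λ terms →
      All (λ t → + 0 ℤ.< proj₁ t
                 × 𝒢≤ H⁺ H⁻ k (proj₁ (proj₂ t)) (proj₂ (proj₂ t))
                 × proj₂ t ⊑ (z , z')) terms
      × z ∷ʳ z' ≡ sumComb (map (λ t → proj₁ t , (proj₁ (proj₂ t) ∷ʳ proj₂ (proj₂ t))) terms)
lemma3p1 _ _ _ _ _ _ _ _ _ _ _ H⁺ H⁻ (H⁺-generates , _) _ _ _ (inj₁ z∈K⁺) ‖z‖≤k =
  unitCombination {H⁺ = H⁺} {H⁻} inj₁ ‖z‖≤k
    (generatorsBelow nonneg-summandsBelowSum H⁺-generates proj₂ z∈K⁺)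
lemma3p1 _ _ _ _ _ _ _ _ _ _ _ H⁺ H⁻ _ (H⁻-generates , _) _ _ (inj₂ z∈K⁻) ‖z‖≤k =
  unitCombination {H⁺ = H⁺} {H⁻} inj₂ ‖z‖≤k
    (generatorsBelow nonpos-summandsBelowSum H⁻-generates proj₂ z∈K⁻)
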